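{- Let $(G, \mathbf{A}(G), \mathbf{B}(G), T, k)$ be an instance of \textsc{Bipartite Steiner $T$-join} and let $v \in \mathbf{B}(G)$. Let $G'$ be obtained from $G$ by contracting all edges between $v$ and its neighbors, so that $v$ and $N_G(v)$ are merged into a single vertex $v'$; let $\mathbf{A}(G') := (\mathbf{A}(G) \setminus N_G(v)) \cup \{v'\}$ and $\mathbf{B}(G') := \mathbf{B}(G) \setminus \{v\}$ be the resulting color classes. Let $T'$ be obtained from $T$ by removing $N_G(v) \cap T$ and adding $v'$ if and only if $|N_G(v) \cap T|$ is odd. Then: (1) if $(G, \mathbf{A}(G), \mathbf{B}(G), T, k)$ has a solution $C$ with $v \in C$, then $(G', \mathbf{A}(G'), \mathbf{B}(G'), T', k-1)$ has a solution; (2) if $(G', \mathbf{A}(G'), \mathbf{B}(G'), T', k-1)$ has a solution, then $(G, \mathbf{A}(G), \mathbf{B}(G), T, k)$ has a solution.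
   Context: An instance of \textsc{Bipartite Steiner $T$-join} consists of a connected bipartite graph $G$ with bipartition $V(G) = \mathbf{A}(G) \uplus \mathbf{B}(G)$, a set $T \subseteq \mathbf{A}(G)$ of terminals and an integer $k$. A solution is a set $C \subseteq \mathbf{B}(G)$ with $|C| \le k$ such that every connected component of $G[C \cup \mathbf{A}(G)]$ contains an even number of vertices of $T$. -}

module Defs where

open import Data.Bool using (Bool; true; false; T; not; _∧_; _∨_; if_then_else_)
open import Data.Nat using (ℕ; _≤_)
open import Data.Nat.Divisibility using (_∣_; _∣?_)
open import Data.Fin using (Fin) renaming (_≟_ to _≟ᶠ_)
open import Data.List using (List; length; filter)
open import Data.Bool.ListAction using (any)
open import Data.List.Membership.Propositional using (_∈_)
open import Data.List.Relation.Unary.Unique.Propositional using (Unique)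
open import Data.Fin.Base using ()
open import Data.List.Base using ()
open import Data.Product using (Σ; ∃; _×_; _,_)
open import Data.Sum using (_⊎_; inj₁; inj₂)
open import Data.Unit using (⊤; tt)
open import Function.Bundles using (_⇔_)
open import Relation.Nullary using (does)
open import Relation.Nullary.Decidable using (T?)
open import Relation.Binary.PropositionalEquality using (_≡_; _≢_)
open import Data.List using (allFin)

-- Graphs with a 2-colouring, on an arbitrary vertex type V.
-- colA x = true  means x ∈ A(G),  colA x = false  means x ∈ B(G).
-- adj is the (Boolean) adjacency relation of a simple graph.

record ColGraph (V : Set) : Set where
  field
    colA : V → Bool
    adj  : V → V → Bool
open ColGraph public

IsBipartite : {V : Set} → ColGraph V → Set
IsBipartite G = (∀ x y → adj G x y ≡ adj G y x)
              × (∀ x y → T (adj G x y) → colA G x ≢ colA G y)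

-- Walks inside the induced subgraph G[S] (S given as a Boolean predicate).
data Walk {V : Set} (G : ColGraph V) (S : V → Bool) : V → V → Set where
  here : ∀ {x} → T (S x) → Walk G S x x
  step : ∀ {x y z} → T (S x) → T (adj G x y) → Walk G S y z → Walk G S x z

Connected : {V : Set} → ColGraph V → Set
Connected G = ∀ x y → Walk G (λ _ → true) x y

HasCard : {V : Set} → (V → Set) → ℕ → Set
HasCard {V} P m = Σ (List V) λ xs → Unique xs × (∀ x → (x ∈ xs) ⇔ P x) × length xs ≡ m

EvenCard : {V : Set} → (V → Set) → Set
EvenCard P = ∃ λ m → HasCard P m × (2 ∣ m)

CA : {V : Set} → ColGraph V → (V → Bool) → V → Bool
CA G C x = colA G x ∨ C x

-- C is a solution of the instance (G, A(G), B(G), Tm, k):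
-- C ⊆ B(G), |C| ≤ k, and every connected component of G[C ∪ A(G)]
-- (namely, the component of any of its vertices x) contains an even
-- number of terminals.
IsSolution : {V : Set} → ColGraph V → (V → Bool) → ℕ → (V → Bool) → Set
IsSolution G Tm k C =
    (∀ x → T (C x) → colA G x ≡ false)
  × (∃ λ m → HasCard (λ x → T (C x)) m × m ≤ k)
  × (∀ x → T (CA G C x) →
       EvenCard (λ y → T (Tm y) × Walk G (CA G C) x y))

HasSolution : {V : Set} → ColGraph V → (V → Bool) → ℕ → Set
HasSolution G Tm k = ∃ λ C → IsSolution G Tm k C

-- The vertices of G' are
--   inj₁ tt        = the new vertex v'
--   inj₂ (u , _)   = an old vertex u ∉ {v} ∪ N_G(v).

module _ {n : ℕ} (G : ColGraph (Fin n)) (v : Fin n) where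

  keep : Fin n → Bool
  keep u = not (does (u ≟ᶠ v)) ∧ not (adj G v u)

  V' : Set
  V' = ⊤ ⊎ Σ (Fin n) (λ u → T (keep u))

  adjMerged : Fin n → Bool
  adjMerged u = adj G v u ∨ any (λ w → adj G v w ∧ adj G w u) (allFin n)

  contract : ColGraph V'
  contract = record { colA = colA' ; adj = adj' }
    where
    colA' : V' → Bool
    colA' (inj₁ _) = true
    colA' (inj₂ (u , _)) = colA G u
    adj' : V' → V' → Bool
    adj' (inj₁ _) (inj₁ _) = false
    adj' (inj₁ _) (inj₂ (u , _)) = adjMerged u
    adj' (inj₂ (u , _)) (inj₁ _) = adjMerged u
    adj' (inj₂ (u , _)) (inj₂ (w , _)) = adj G u w

  nbTerm : (Fin n → Bool) → ℕ
  nbTerm Tm = length (filter (λ w → T? (adj G v w ∧ Tm w)) (allFin n))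

  contractT : (Fin n → Bool) → V' → Bool
  contractT Tm (inj₁ _) = not (does (2 ∣? nbTerm Tm))
  contractT Tm (inj₂ (u , _)) = Tm u

module Submission where

-- Let π : V(G) → V(G′) collapse
-- {v} ∪ N(v) to v′ and ρ : V(G′) → V(G) send v′ to v and fix the rest.  If C
-- and C′ are vertex sets of G and G′ that agree on the surviving vertices and
-- v ∈ C, then all of {v} ∪ N(v) lies in one component of G[S], S = C ∪ A(G),
-- so walks of G[S] and of G′[S′], S′ = C′ ∪ A(G′), correspond via π and ρ.
-- Hence the component of x in G[S] and that of π x in G′[S′] contain the same
-- surviving terminals, plus either all of N(v) ∩ T or (if it is odd) v′; the
-- two counts have equal parity.  Moreover |C| = |C′| + 1.

open import Defs
open import Data.Bool using (Bool; T; true; false; not; _∧_; _∨_; if_then_else_)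
open import Data.Bool.Properties using (T-irrelevant; T-∧; T-∨; T-≡)
open import Data.Nat using (ℕ; zero; suc; _+_; _∸_; _%_; _≤_; s≤s)
open import Data.Nat.Properties using (suc-injective; ∸-monoˡ-≤; m+[n∸m]≡n)
open import Data.Nat.DivMod using (m%n<n; %-distribˡ-+)
open import Data.Nat.Divisibility using (_∣_; _∣?_; m%n≡0⇒n∣m; n∣m⇒m%n≡0)
open import Data.Fin using (Fin; _≟_)
open import Data.Fin.Properties using (any?)
open import Data.List using (List; []; _∷_; _++_; map; length; filter; allFin)
open import Data.List.Properties using (length-++; length-map)
open import Data.List.Membership.Propositional using (_∈_; lose)
open import Data.List.Membership.Propositional.Properties
  using (∈-allFin; ∈-filter⁺; ∈-filter⁻; ∈-++⁺ˡ; ∈-++⁺ʳ; ∈-++⁻; ∈-map⁺; ∈-map⁻)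
open import Data.List.Membership.Propositional.Properties.WithK using (unique∧set⇒bag)
open import Data.List.Relation.Binary.BagAndSetEquality using (∼bag⇒↭)
open import Data.List.Relation.Binary.Permutation.Propositional.Properties using (↭-length)
open import Data.List.Relation.Unary.Any using (here; there; satisfied)
open import Data.List.Relation.Unary.Any.Properties using (any⁺; any⁻)
open import Data.List.Relation.Unary.AllPairs using ([]; _∷_)
open import Data.List.Relation.Unary.All as All using (All; []; _∷_)
open import Data.List.Relation.Unary.All.Properties using (¬Any⇒All¬; All¬⇒¬Any)
open import Data.List.Relation.Unary.Unique.Propositional using (Unique)
open import Data.List.Relation.Unary.Unique.Propositional.Properties
  using (allFin⁺; filter⁺; ++⁺; map⁺)
open import Data.Unit using (tt)
open import Data.Empty using (⊥; ⊥-elim)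
open import Data.Product using (Σ; ∃; _×_; _,_; proj₁; proj₂)
open import Data.Sum using (_⊎_; inj₁; inj₂; [_,_]′)
open import Data.Sum.Properties using (inj₁-injective; inj₂-injective)
open import Function using (_∘_)
open import Function.Bundles using (_⇔_; mk⇔; Equivalence)
open import Relation.Nullary using (¬_; Dec; yes; no; does; contradiction)
open import Relation.Nullary.Decidable using (T?; _×-dec_; decidable-stable)
open import Relation.Unary using (Decidable)
open import Relation.Binary.PropositionalEquality
  using (_≡_; _≢_; refl; sym; trans; cong; cong₂; subst; module ≡-Reasoning)

module _ {A : Set} where

  -- The cardinality of a predicate is well defined: two duplicate-free lists
  -- with the same members are permutations of each other.
  card-unique : ∀ {P : A → Set} {m m′} → HasCard P m → HasCard P m′ → m ≡ m′
  card-unique (xs , xs! , xs⇔ , refl) (ys , ys! , ys⇔ , refl) =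
    ↭-length (∼bag⇒↭ (unique∧set⇒bag xs! ys! λ {x} →
      mk⇔ (Equivalence.from (ys⇔ x) ∘ Equivalence.to (xs⇔ x))
          (Equivalence.from (xs⇔ x) ∘ Equivalence.to (ys⇔ x))))

  card-resp : ∀ {P Q : A → Set} {m} → (∀ x → P x ⇔ Q x) → HasCard P m → HasCard Q m
  card-resp P⇔Q (xs , xs! , xs⇔ , len) =
    xs , xs! , (λ x → mk⇔ (Equivalence.to (P⇔Q x) ∘ Equivalence.to (xs⇔ x))
                           (Equivalence.from (xs⇔ x) ∘ Equivalence.from (P⇔Q x))) , len

  card-empty : ∀ {P : A → Set} → (∀ x → ¬ P x) → HasCard P 0
  card-empty ¬P = [] , [] , (λ x → mk⇔ (λ ()) (⊥-elim ∘ ¬P x)) , refl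

  card-singleton : (a : A) → HasCard (_≡ a) 1
  card-singleton a = a ∷ [] , [] ∷ [] , (λ x → mk⇔ (λ { (here x≡a) → x≡a }) here) , refl

  card-const : ∀ {P : A → Set} {R : Set} {m} → HasCard P m → (R? : Dec R) →
               HasCard (λ x → P x × R) (if does R? then m else 0)
  card-const hasP (yes r) = card-resp (λ x → mk⇔ (_, r) proj₁) hasP
  card-const hasP (no ¬r) = card-empty (λ x → ¬r ∘ proj₂)

  card-join : ∀ {P : A → Set} {a b} (q : A → Bool) →
              HasCard (λ x → P x × ¬ T (q x)) a → HasCard (λ x → P x × T (q x)) b →
              HasCard P (a + b)
  card-join {P} q (xs , xs! , xs⇔ , refl) (ys , ys! , ys⇔ , refl) =
    xs ++ ys , ++⁺ xs! ys! disjoint , (λ x → mk⇔ (to x) (from x)) , length-++ xs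
    where
    disjoint : ∀ {x} → ¬ (x ∈ xs × x ∈ ys)
    disjoint {x} (x∈xs , x∈ys) =
      proj₂ (Equivalence.to (xs⇔ x) x∈xs) (proj₂ (Equivalence.to (ys⇔ x) x∈ys))
    to : ∀ x → x ∈ xs ++ ys → P x
    to x x∈ with ∈-++⁻ xs x∈
    ... | inj₁ x∈xs = proj₁ (Equivalence.to (xs⇔ x) x∈xs)
    ... | inj₂ x∈ys = proj₁ (Equivalence.to (ys⇔ x) x∈ys)
    from : ∀ x → P x → x ∈ xs ++ ys
    from x px with T? (q x)
    ... | yes qx = ∈-++⁺ʳ xs (Equivalence.from (ys⇔ x) (px , qx))
    ... | no ¬qx = ∈-++⁺ˡ (Equivalence.from (xs⇔ x) (px , ¬qx))

card-filter : ∀ {n} {P : Fin n → Set} (P? : Decidable P) → HasCard P (length (filter P? (allFin n)))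
card-filter {n} P? =
  filter P? (allFin n) , filter⁺ P? (allFin⁺ n) ,
  (λ x → mk⇔ (proj₂ ∘ ∈-filter⁻ P? {xs = allFin n}) (∈-filter⁺ P? (∈-allFin x))) , refl

card-⊎ : ∀ {A B : Set} {P : A ⊎ B → Set} {a b} →
         HasCard (P ∘ inj₁) a → HasCard (P ∘ inj₂) b → HasCard P (a + b)
card-⊎ {P = P} (xs , xs! , xs⇔ , refl) (ys , ys! , ys⇔ , refl) =
  map inj₁ xs ++ map inj₂ ys ,
  ++⁺ (map⁺ inj₁-injective xs!) (map⁺ inj₂-injective ys!) disjoint ,
  (λ x → mk⇔ (to x) (from x)) ,
  trans (length-++ (map inj₁ xs)) (cong₂ _+_ (length-map inj₁ xs) (length-map inj₂ ys))
  where
  disjoint : ∀ {x} → ¬ (x ∈ map inj₁ xs × x ∈ map inj₂ ys)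
  disjoint (x∈₁ , x∈₂) with ∈-map⁻ inj₁ x∈₁ | ∈-map⁻ inj₂ x∈₂
  ... | _ , _ , refl | _ , _ , ()
  to : ∀ x → x ∈ map inj₁ xs ++ map inj₂ ys → P x
  to x x∈ with ∈-++⁻ (map inj₁ xs) x∈
  ... | inj₁ x∈₁ with ∈-map⁻ inj₁ x∈₁
  ...   | a , a∈ , refl = Equivalence.to (xs⇔ a) a∈
  to x x∈ | inj₂ x∈₂ with ∈-map⁻ inj₂ x∈₂
  ...   | b , b∈ , refl = Equivalence.to (ys⇔ b) b∈
  from : ∀ x → P x → x ∈ map inj₁ xs ++ map inj₂ ys
  from (inj₁ a) pa = ∈-++⁺ˡ (∈-map⁺ inj₁ (Equivalence.from (xs⇔ a) pa))
  from (inj₂ b) pb = ∈-++⁺ʳ (map inj₁ xs) (∈-map⁺ inj₂ (Equivalence.from (ys⇔ b) pb))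

module _ {A : Set} (q : A → Bool) where

  attach : List A → List (Σ A (T ∘ q))
  attach [] = []
  attach (x ∷ xs) with T? (q x)
  ... | yes qx = (x , qx) ∷ attach xs
  ... | no _   = attach xs

  ∈-attach⁻ : ∀ {s} xs → s ∈ attach xs → proj₁ s ∈ xs
  ∈-attach⁻ (x ∷ xs) s∈ with T? (q x) | s∈
  ... | yes _ | here refl = here refl
  ... | yes _ | there s∈′ = there (∈-attach⁻ xs s∈′)
  ... | no _  | s∈′       = there (∈-attach⁻ xs s∈′)

  ∈-attach⁺ : ∀ {x} xs (qx : T (q x)) → x ∈ xs → (x , qx) ∈ attach xs
  ∈-attach⁺ (y ∷ xs) qx x∈ with T? (q y) | x∈
  ... | yes qy | here refl = here (cong (y ,_) (T-irrelevant qx qy))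
  ... | no ¬qy | here refl = contradiction qx ¬qy
  ... | yes _  | there x∈′ = there (∈-attach⁺ xs qx x∈′)
  ... | no _   | there x∈′ = ∈-attach⁺ xs qx x∈′

  attach-unique : ∀ xs → Unique xs → Unique (attach xs)
  attach-unique [] [] = []
  attach-unique (x ∷ xs) (x∉xs ∷ xs!) with T? (q x)
  ... | yes _ = ¬Any⇒All¬ (attach xs) (All¬⇒¬Any x∉xs ∘ ∈-attach⁻ xs) ∷ attach-unique xs xs!
  ... | no _  = attach-unique xs xs!

  length-attach : ∀ xs → All (T ∘ q) xs → length (attach xs) ≡ length xs
  length-attach [] [] = refl
  length-attach (x ∷ xs) (qx ∷ qxs) with T? (q x)
  ... | yes _  = cong suc (length-attach xs qxs)
  ... | no ¬qx = contradiction qx ¬qx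

  card-subtype : ∀ {P : A → Set} {m} →
                 HasCard (λ x → P x × T (q x)) m → HasCard (λ s → P (proj₁ s)) m
  card-subtype {P} (xs , xs! , xs⇔ , refl) =
    attach xs , attach-unique xs xs! , (λ s → mk⇔ (to s) (from s)) ,
    length-attach xs (All.tabulate (proj₂ ∘ Equivalence.to (xs⇔ _)))
    where
    to : ∀ s → s ∈ attach xs → P (proj₁ s)
    to s s∈ = proj₁ (Equivalence.to (xs⇔ (proj₁ s)) (∈-attach⁻ xs s∈))
    from : ∀ s → P (proj₁ s) → s ∈ attach xs
    from (x , qx) px = ∈-attach⁺ xs qx (Equivalence.from (xs⇔ x) (px , qx))

odd%2 : ∀ m → ¬ 2 ∣ m → m % 2 ≡ 1
odd%2 m ¬2∣m with m % 2 in eq | m%n<n m 2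
... | 0           | _             = contradiction (m%n≡0⇒n∣m m 2 eq) ¬2∣m
... | 1           | _             = refl
... | suc (suc _) | s≤s (s≤s ())

even-+-resp : ∀ a b c → b % 2 ≡ c % 2 → 2 ∣ b + a → 2 ∣ c + a
even-+-resp a b c b≡c 2∣b+a = m%n≡0⇒n∣m (c + a) 2 (begin
  (c + a) % 2                 ≡⟨ %-distribˡ-+ c a 2 ⟩
  ((c % 2) + (a % 2)) % 2     ≡⟨ cong (λ r → (r + a % 2) % 2) (sym b≡c) ⟩
  ((b % 2) + (a % 2)) % 2     ≡⟨ sym (%-distribˡ-+ b a 2) ⟩
  (b + a) % 2                 ≡⟨ n∣m⇒m%n≡0 (b + a) 2 2∣b+a ⟩
  0                           ∎)
  where open ≡-Reasoning

even-transfer : ∀ {A B : Set} {P : A → Set} {Q : B → Set} {a b c} →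
                HasCard P (b + a) → HasCard Q (c + a) → b % 2 ≡ c % 2 →
                EvenCard P → EvenCard Q
even-transfer {a = a} {b} {c} hasP hasQ b≡c (m , hasP′ , 2∣m) =
  c + a , hasQ , even-+-resp a b c b≡c (subst (2 ∣_) (card-unique hasP′ hasP) 2∣m)

-- Contracting N terminals to one vertex that is a terminal iff N is odd,
-- where both are counted only when reachable (r), preserves parity.
parity-of-contraction : ∀ N (2∣N? : Dec (2 ∣ N)) (r : Bool) →
  (if r then N else 0) % 2 ≡ (if not (does 2∣N?) ∧ r then 1 else 0) % 2
parity-of-contraction N (yes _)    false = refl
parity-of-contraction N (no _)     false = refl
parity-of-contraction N (yes 2∣N)  true  = n∣m⇒m%n≡0 N 2 2∣N
parity-of-contraction N (no ¬2∣N) true  = odd%2 N ¬2∣N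

module _ {V : Set} {G : ColGraph V} {S : V → Bool} where

  walk-start : ∀ {a b} → Walk G S a b → T (S a)
  walk-start (here sa) = sa
  walk-start (step sa _ _) = sa

  walk-end : ∀ {a b} → Walk G S a b → T (S b)
  walk-end (here sb) = sb
  walk-end (step _ _ w) = walk-end w

  infixr 5 _++ʷ_
  _++ʷ_ : ∀ {a b c} → Walk G S a b → Walk G S b c → Walk G S a c
  here _ ++ʷ w′ = w′
  step sa e w ++ʷ w′ = step sa e (w ++ʷ w′)

  walk-mono : ∀ {S′ : V → Bool} {a b} → (∀ u → T (S u) → T (S′ u)) → Walk G S a b → Walk G S′ a b
  walk-mono S⊆S′ (here sa) = here (S⊆S′ _ sa)
  walk-mono S⊆S′ (step sa e w) = step (S⊆S′ _ sa) e (walk-mono S⊆S′ w)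

  walk-reverse : (∀ {x y} → T (adj G x y) → T (adj G y x)) → ∀ {a b} → Walk G S a b → Walk G S b a
  walk-reverse sym-adj (here sa) = here sa
  walk-reverse sym-adj (step sa e w) = walk-reverse sym-adj w ++ʷ step (walk-start w) (sym-adj e) (here sa)

module _ {n : ℕ} where

  _-ᵛ_ : (Fin n → Bool) → Fin n → Fin n → Bool
  (S -ᵛ x) u = S u ∧ not (does (u ≟ x))

  T-≢ : ∀ (u x : Fin n) → T (not (does (u ≟ x))) ⇔ (u ≢ x)
  T-≢ u x with u ≟ x
  ... | yes refl = mk⇔ (λ ()) (λ u≢u → contradiction refl u≢u)
  ... | no u≢x = mk⇔ (λ _ → u≢x) (λ _ → _)

  -ᵛ⇔ : ∀ S x u → T ((S -ᵛ x) u) ⇔ (T (S u) × u ≢ x)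
  -ᵛ⇔ S x u = mk⇔ (λ t → let su , t′ = Equivalence.to (T-∧ {S u}) t in su , Equivalence.to (T-≢ u x) t′)
                  (λ (su , u≢x) → Equivalence.from (T-∧ {S u}) (su , Equivalence.from (T-≢ u x) u≢x))

  size : (Fin n → Bool) → ℕ
  size S = length (filter (T? ∘ S) (allFin n))

  size-remove : ∀ {S x} → T (S x) → size S ≡ suc (size (S -ᵛ x))
  size-remove {S} {x} sx = card-unique (card-filter (T? ∘ S))
    (card-join (λ u → not (does (u ≟ x))) (card-resp is-x (card-singleton x))
               (card-resp (λ u → T-∧ {S u}) (card-filter (T? ∘ (S -ᵛ x)))))
    where
    is-x : ∀ u → (u ≡ x) ⇔ (T (S u) × ¬ T (not (does (u ≟ x))))
    is-x u = mk⇔ (λ { refl → sx , λ t → Equivalence.to (T-≢ x x) t refl })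
                 (λ (_ , ¬t) → decidable-stable (u ≟ x) (¬t ∘ Equivalence.from (T-≢ u x)))

module _ {n : ℕ} (G : ColGraph (Fin n)) where

  last-exit : ∀ {S a y} x → y ≢ x → Walk G S a y →
              Walk G (S -ᵛ x) a y ⊎ ∃ λ z → T (adj G x z) × Walk G (S -ᵛ x) z y
  last-exit {S} x y≢x (here sy) = inj₁ (here (Equivalence.from (-ᵛ⇔ S x _) (sy , y≢x)))
  last-exit {S} {a} x y≢x (step {y = b} sa e w) with last-exit x y≢x w
  ... | inj₂ exit = inj₂ exit
  ... | inj₁ w′ with a ≟ x
  ...   | yes refl = inj₂ (b , e , w′)
  ...   | no a≢x = inj₁ (step (Equivalence.from (-ᵛ⇔ S x a) (sa , a≢x)) e w′)

  -- Reachability inside G[S] is decidable, by recursion on the size of S: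
  -- a walk from a to y ≠ a continues, after its last visit of a, inside S - a.
  reach-within? : ∀ m S → size S ≡ m → ∀ a y → Dec (Walk G S a y)
  reach-within? m S size≡m a y with T? (S a)
  ... | no ¬sa = no (¬sa ∘ walk-start)
  ... | yes sa with a ≟ y
  ...   | yes refl = yes (here sa)
  reach-within? zero S size≡0 a y | yes sa | no a≢y
    with () ← trans (sym (size-remove {S = S} sa)) size≡0
  reach-within? (suc m) S size≡m a y | yes sa | no a≢y
    with any? (λ z → T? (adj G a z) ×-dec
                     reach-within? m (S -ᵛ a) (suc-injective (trans (sym (size-remove {S = S} sa)) size≡m)) z y)
  ... | yes (z , e , w) = yes (step sa e (walk-mono (λ u → proj₁ ∘ Equivalence.to (-ᵛ⇔ S a u)) w))
  ... | no ¬exit = no λ w → case-last-exit (last-exit a (a≢y ∘ sym) w)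
    where
    case-last-exit : Walk G (S -ᵛ a) a y ⊎ (∃ λ z → T (adj G a z) × Walk G (S -ᵛ a) z y) → ⊥
    case-last-exit (inj₁ w′) = proj₂ (Equivalence.to (-ᵛ⇔ S a a) (walk-start w′)) refl
    case-last-exit (inj₂ exit) = ¬exit exit

  reach? : ∀ S a y → Dec (Walk G S a y)
  reach? S = reach-within? (size S) S refl

module _ {n : ℕ} (G : ColGraph (Fin n)) (v : Fin n) where

  π : Fin n → V' G v
  π u with T? (keep G v u)
  ... | yes k = inj₂ (u , k)
  ... | no _  = inj₁ tt

  ρ : V' G v → Fin n
  ρ (inj₁ _) = v
  ρ (inj₂ (u , _)) = u

  π-kept : ∀ {u} (k : T (keep G v u)) → π u ≡ inj₂ (u , k)
  π-kept {u} k with T? (keep G v u)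
  ... | yes k′ = cong (λ k″ → inj₂ (u , k″)) (T-irrelevant k′ k)
  ... | no ¬k = contradiction k ¬k

  π-merged : ∀ {u} → ¬ T (keep G v u) → π u ≡ inj₁ tt
  π-merged {u} ¬k with T? (keep G v u)
  ... | yes k = contradiction k ¬k
  ... | no _ = refl

  merged⇔ : ∀ u → (¬ T (keep G v u)) ⇔ (u ≡ v ⊎ T (adj G v u))
  merged⇔ u with u ≟ v | adj G v u
  ... | yes u≡v | _     = mk⇔ (λ _ → inj₁ u≡v) (λ _ ())
  ... | no _    | true  = mk⇔ (λ _ → inj₂ _) (λ _ ())
  ... | no u≢v  | false = mk⇔ (λ ¬k → contradiction _ ¬k) [ (λ u≡v _ → u≢v u≡v) , (λ ()) ]′

  π∘ρ : ∀ p → π (ρ p) ≡ p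
  π∘ρ (inj₁ tt) = π-merged (Equivalence.from (merged⇔ v) (inj₁ refl))
  π∘ρ (inj₂ (u , k)) = π-kept k

  adjMerged⇔ : ∀ u → T (adjMerged G v u) ⇔ (∃ λ w → ¬ T (keep G v w) × T (adj G w u))
  adjMerged⇔ u = mk⇔ to from
    where
    to : T (adjMerged G v u) → ∃ λ w → ¬ T (keep G v w) × T (adj G w u)
    to t with Equivalence.to (T-∨ {adj G v u}) t
    ... | inj₁ v~u = v , Equivalence.from (merged⇔ v) (inj₁ refl) , v~u
    ... | inj₂ t′ with satisfied (any⁻ _ (allFin n) t′)
    ...   | w , t″ = let v~w , w~u = Equivalence.to (T-∧ {adj G v w}) t″ in
                     w , Equivalence.from (merged⇔ w) (inj₂ v~w) , w~u
    from : (∃ λ w → ¬ T (keep G v w) × T (adj G w u)) → T (adjMerged G v u)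
    from (w , ¬kw , w~u) with Equivalence.to (merged⇔ w) ¬kw
    ... | inj₁ refl = Equivalence.from (T-∨ {adj G v u}) (inj₁ w~u)
    ... | inj₂ v~w = Equivalence.from (T-∨ {adj G v u}) (inj₂
            (any⁺ _ (lose (∈-allFin w) (Equivalence.from (T-∧ {adj G v w}) (v~w , w~u)))))

  pushdown : (Fin n → Bool) → V' G v → Bool
  pushdown C (inj₁ _) = false
  pushdown C (inj₂ (u , _)) = C u

  pullback : (V' G v → Bool) → Fin n → Bool
  pullback C′ u with T? (keep G v u)
  ... | yes k = C′ (inj₂ (u , k))
  ... | no _  = does (u ≟ v)

  pullback-agrees : ∀ C′ u (k : T (keep G v u)) → C′ (inj₂ (u , k)) ≡ pullback C′ u
  pullback-agrees C′ u k with T? (keep G v u)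
  ... | yes k′ = cong (λ k″ → C′ (inj₂ (u , k″))) (T-irrelevant k k′)
  ... | no ¬k  = contradiction k ¬k

  v∈pullback : ∀ C′ → T (pullback C′ v)
  v∈pullback C′ with T? (keep G v v)
  ... | yes k = contradiction k (Equivalence.from (merged⇔ v) (inj₁ refl))
  ... | no _ with v ≟ v
  ...   | yes _  = _
  ...   | no v≢v = v≢v refl

  pullback⊆B : ∀ C′ → colA G v ≡ false → (∀ p → T (C′ p) → colA (contract G v) p ≡ false) →
               ∀ u → T (pullback C′ u) → colA G u ≡ false
  pullback⊆B C′ v∈B C′⊆B′ u t with T? (keep G v u)
  ... | yes k = C′⊆B′ (inj₂ (u , k)) t
  ... | no _ with u ≟ v
  ...   | yes refl = v∈B

  pushdown⊆B : ∀ C → (∀ u → T (C u) → colA G u ≡ false) →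
               ∀ p → T (pushdown C p) → colA (contract G v) p ≡ false
  pushdown⊆B C C⊆B (inj₂ (u , _)) t = C⊆B u t

module Compatible {n : ℕ} (G : ColGraph (Fin n)) (v : Fin n)
                  (bip : IsBipartite G) (v∈B : colA G v ≡ false)
                  (C : Fin n → Bool) (C′ : V' G v → Bool) (v∈C : T (C v))
                  (agree : ∀ u (k : T (keep G v u)) → C′ (inj₂ (u , k)) ≡ C u) where

  G′ : ColGraph (V' G v)
  G′ = contract G v

  S : Fin n → Bool
  S = CA G C

  S′ : V' G v → Bool
  S′ = CA G′ C′

  adj-sym : ∀ {x y} → T (adj G x y) → T (adj G y x)
  adj-sym {x} {y} = subst T (proj₁ bip x y)

  nbr∈A : ∀ {u} → T (adj G v u) → colA G u ≡ true
  nbr∈A {u} v~u with colA G u in eq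
  ... | true = refl
  ... | false = contradiction (trans v∈B (sym eq)) (proj₂ bip v u v~u)

  merged∈S : ∀ {u} → ¬ T (keep G v u) → T (S u)
  merged∈S {u} ¬k with Equivalence.to (merged⇔ G v u) ¬k
  ... | inj₁ refl = Equivalence.from (T-∨ {colA G v}) (inj₂ v∈C)
  ... | inj₂ v~u  = Equivalence.from (T-∨ {colA G u}) (inj₁ (Equivalence.from T-≡ (nbr∈A v~u)))

  v∈S : T (S v)
  v∈S = merged∈S (Equivalence.from (merged⇔ G v v) (inj₁ refl))

  S′≡S∘ρ : ∀ p → S′ p ≡ S (ρ G v p)
  S′≡S∘ρ (inj₁ _) = sym (Equivalence.to T-≡ v∈S)
  S′≡S∘ρ (inj₂ (u , k)) = cong (colA G u ∨_) (agree u k)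

  ρ∈S⇒∈S′ : ∀ p → T (S (ρ G v p)) → T (S′ p)
  ρ∈S⇒∈S′ p = subst T (sym (S′≡S∘ρ p))

  ∈S′⇒ρ∈S : ∀ p → T (S′ p) → T (S (ρ G v p))
  ∈S′⇒ρ∈S p = subst T (S′≡S∘ρ p)

  π∈S′ : ∀ {u} → T (S u) → T (S′ (π G v u))
  π∈S′ {u} su with T? (keep G v u)
  ... | yes k = ρ∈S⇒∈S′ (inj₂ (u , k)) su
  ... | no _  = _

  merged-walk : ∀ {w} → ¬ T (keep G v w) → Walk G S w v
  merged-walk {w} ¬k with Equivalence.to (merged⇔ G v w) ¬k
  ... | inj₁ refl = here v∈S
  ... | inj₂ v~w  = step (merged∈S ¬k) (adj-sym v~w) (here v∈S)

  edge-image : ∀ {x y} → T (S x) → T (S y) → T (adj G x y) → Walk G′ S′ (π G v x) (π G v y)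
  edge-image {x} {y} sx sy x~y with T? (keep G v x) | T? (keep G v y)
  ... | yes kx | yes ky = step (ρ∈S⇒∈S′ (inj₂ (x , kx)) sx) x~y (here (ρ∈S⇒∈S′ (inj₂ (y , ky)) sy))
  ... | yes kx | no ¬ky =
    step (ρ∈S⇒∈S′ (inj₂ (x , kx)) sx) (Equivalence.from (adjMerged⇔ G v x) (y , ¬ky , adj-sym x~y)) (here _)
  ... | no ¬kx | yes ky =
    step _ (Equivalence.from (adjMerged⇔ G v y) (x , ¬kx , x~y)) (here (ρ∈S⇒∈S′ (inj₂ (y , ky)) sy))
  ... | no _   | no _   = here _

  walk-image : ∀ {x y} → Walk G S x y → Walk G′ S′ (π G v x) (π G v y)
  walk-image (here sx) = here (π∈S′ sx)
  walk-image (step sx x~y w) = edge-image sx (walk-start w) x~y ++ʷ walk-image w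

  edge-preimage : ∀ p q → T (S′ p) → T (S′ q) → T (adj G′ p q) → Walk G S (ρ G v p) (ρ G v q)
  edge-preimage (inj₁ _) q@(inj₂ (u , _)) _ sq t with Equivalence.to (adjMerged⇔ G v u) t
  ... | w , ¬kw , w~u =
    walk-reverse adj-sym (merged-walk ¬kw) ++ʷ step (merged∈S ¬kw) w~u (here (∈S′⇒ρ∈S q sq))
  edge-preimage p@(inj₂ (u , _)) (inj₁ _) sp _ t with Equivalence.to (adjMerged⇔ G v u) t
  ... | w , ¬kw , w~u = step (∈S′⇒ρ∈S p sp) (adj-sym w~u) (merged-walk ¬kw)
  edge-preimage (inj₁ _) (inj₁ _) _ _ ()
  edge-preimage p@(inj₂ _) q@(inj₂ _) sp sq e = step (∈S′⇒ρ∈S p sp) e (here (∈S′⇒ρ∈S q sq))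

  walk-preimage : ∀ {p q} → Walk G′ S′ p q → Walk G S (ρ G v p) (ρ G v q)
  walk-preimage (here sp) = here (∈S′⇒ρ∈S _ sp)
  walk-preimage (step {x = p} {y = q} sp e w) =
    edge-preimage p q sp (walk-start w) e ++ʷ walk-preimage w

  to-representative : ∀ {x} → T (S x) → Walk G S x (ρ G v (π G v x))
  to-representative {x} sx with T? (keep G v x)
  ... | yes _ = here sx
  ... | no ¬k = merged-walk ¬k

  reach⇔ : ∀ {x} → T (S x) → ∀ p → Walk G′ S′ (π G v x) p ⇔ Walk G S x (ρ G v p)
  reach⇔ sx p = mk⇔ (λ w′ → to-representative sx ++ʷ walk-preimage w′)
                    (λ w → subst (Walk G′ S′ _) (π∘ρ G v p) (walk-image w))

  module Terminals (Tm : Fin n → Bool) (Tm⊆A : ∀ u → T (Tm u) → colA G u ≡ true)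
                   {x : Fin n} (sx : T (S x)) where

    Reach : Fin n → Set
    Reach y = T (Tm y) × Walk G S x y

    Reach′ : V' G v → Set
    Reach′ p = T (contractT G v Tm p) × Walk G′ S′ (π G v x) p

    reach-v? : Dec (Walk G S x v)
    reach-v? = reach? G S x v

    v′∈T′? : Dec (T (contractT G v Tm (inj₁ tt)))
    v′∈T′? = T? (contractT G v Tm (inj₁ tt))

    surviving? : Decidable (λ y → Reach y × T (keep G v y))
    surviving? y = (T? (Tm y) ×-dec reach? G S x y) ×-dec T? (keep G v y)

    surviving : ℕ
    surviving = length (filter surviving? (allFin n))

    -- The merged terminals are the terminal neighbours of v (v ∈ B(G) is no
    -- terminal), and they are reachable from x exactly when v is.
    merged-terminals⇔ : ∀ y → (T (adj G v y ∧ Tm y) × Walk G S x v) ⇔ (Reach y × ¬ T (keep G v y))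
    merged-terminals⇔ y = mk⇔ to from
      where
      to : T (adj G v y ∧ Tm y) × Walk G S x v → Reach y × ¬ T (keep G v y)
      to (t , w) = let v~y , ty = Equivalence.to (T-∧ {adj G v y}) t
                       ¬ky = Equivalence.from (merged⇔ G v y) (inj₂ v~y) in
                   (ty , w ++ʷ step v∈S v~y (here (merged∈S ¬ky))) , ¬ky
      from : Reach y × ¬ T (keep G v y) → T (adj G v y ∧ Tm y) × Walk G S x v
      from ((ty , w) , ¬ky) with Equivalence.to (merged⇔ G v y) ¬ky
      ... | inj₁ refl = contradiction (trans (sym (Tm⊆A v ty)) v∈B) λ ()
      ... | inj₂ v~y = Equivalence.from (T-∧ {adj G v y}) (v~y , ty) ,
                       w ++ʷ step (walk-end w) (adj-sym v~y) (here v∈S)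

    merged-count v′-count : ℕ
    merged-count = if does reach-v? then nbTerm G v Tm else 0
    v′-count = if does (v′∈T′? ×-dec reach-v?) then 1 else 0

    card-Reach : HasCard Reach (merged-count + surviving)
    card-Reach = card-join (keep G v)
      (card-resp merged-terminals⇔ (card-const (card-filter (λ w → T? (adj G v w ∧ Tm w))) reach-v?))
      (card-filter surviving?)

    card-Reach′ : HasCard Reach′ (v′-count + surviving)
    card-Reach′ = card-⊎
      (card-resp (λ { tt → mk⇔ (λ (_ , t , w) → t , Equivalence.from (reach⇔ sx (inj₁ tt)) w)
                               (λ (t , w′) → refl , t , Equivalence.to (reach⇔ sx (inj₁ tt)) w′) })
                 (card-const (card-singleton tt) (v′∈T′? ×-dec reach-v?)))
      (card-resp (λ { (u , k) → mk⇔ (λ (t , w) → t , Equivalence.from (reach⇔ sx (inj₂ (u , k))) w)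
                                    (λ (t , w′) → t , Equivalence.to (reach⇔ sx (inj₂ (u , k))) w′) })
                 (card-subtype (keep G v) (card-filter surviving?)))

    even⇔ : EvenCard Reach ⇔ EvenCard Reach′
    even⇔ = mk⇔ (even-transfer {a = surviving} {merged-count} {v′-count} card-Reach card-Reach′ parity)
                (even-transfer {a = surviving} {v′-count} {merged-count} card-Reach′ card-Reach (sym parity))
      where
      parity : merged-count % 2 ≡ v′-count % 2
      parity = parity-of-contraction (nbTerm G v Tm) (2 ∣? nbTerm G v Tm) (does reach-v?)

  module Solutions (Tm : Fin n → Bool) (Tm⊆A : ∀ u → T (Tm u) → colA G u ≡ true)
                   (C⊆B : ∀ u → T (C u) → colA G u ≡ false)
                   (C′⊆B′ : ∀ p → T (C′ p) → colA G′ p ≡ false) where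

    surviving-in-C? : Decidable (λ u → T (C u) × T (keep G v u))
    surviving-in-C? u = T? (C u) ×-dec T? (keep G v u)

    surviving-in-C : ℕ
    surviving-in-C = length (filter surviving-in-C? (allFin n))

    -- v is the only merged vertex in C, since N(v) ⊆ A(G).
    card-C : HasCard (T ∘ C) (1 + surviving-in-C)
    card-C = card-join (keep G v) (card-resp only-v (card-singleton v)) (card-filter surviving-in-C?)
      where
      only-v : ∀ u → (u ≡ v) ⇔ (T (C u) × ¬ T (keep G v u))
      only-v u = mk⇔ (λ { refl → v∈C , Equivalence.from (merged⇔ G v v) (inj₁ refl) }) from
        where
        from : T (C u) × ¬ T (keep G v u) → u ≡ v
        from (cu , ¬ku) with Equivalence.to (merged⇔ G v u) ¬ku
        ... | inj₁ u≡v = u≡v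
        ... | inj₂ v~u = contradiction (trans (sym (nbr∈A v~u)) (C⊆B u cu)) λ ()

    -- v′ ∈ A(G′) is not in C′, and C′ agrees with C on the survivors.
    card-C′ : HasCard (T ∘ C′) surviving-in-C
    card-C′ = card-⊎ (card-empty (λ _ c′ → contradiction (C′⊆B′ (inj₁ tt) c′) λ ()))
                     (card-resp (λ { (u , k) → mk⇔ (subst T (sym (agree u k))) (subst T (agree u k)) })
                                (card-subtype (keep G v) (card-filter surviving-in-C?)))

    -- Each vertex p of G′[S′] is π (ρ p), with ρ p in G[S].
    solution-down : ∀ {k} → IsSolution G Tm k C → IsSolution G′ (contractT G v Tm) (k ∸ 1) C′
    solution-down {k} (_ , (m , card , m≤k) , even) =
      C′⊆B′ , (surviving-in-C , card-C′ , ∸-monoˡ-≤ 1 (subst (_≤ k) (card-unique card card-C) m≤k)) ,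
      λ p sp → let open Terminals Tm Tm⊆A (∈S′⇒ρ∈S p sp) in
               subst (λ q → EvenCard λ y → T (contractT G v Tm y) × Walk G′ S′ q y) (π∘ρ G v p)
                     (Equivalence.to even⇔ (even (ρ G v p) (∈S′⇒ρ∈S p sp)))

    solution-up : ∀ {k} → 1 ≤ k → IsSolution G′ (contractT G v Tm) (k ∸ 1) C′ → IsSolution G Tm k C
    solution-up {k} 1≤k (_ , (m′ , card′ , m′≤k-1) , even′) =
      C⊆B , (1 + surviving-in-C , card-C , size≤k) ,
      λ x sx → let open Terminals Tm Tm⊆A sx in Equivalence.from even⇔ (even′ (π G v x) (π∈S′ sx))
      where
      size≤k : 1 + surviving-in-C ≤ k
      size≤k = subst (1 + surviving-in-C ≤_) (m+[n∸m]≡n 1≤k)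
                     (s≤s (subst (_≤ k ∸ 1) (card-unique card′ card-C′) m′≤k-1))

lemma4p7 : (n : ℕ) (G : ColGraph (Fin n)) (Tm : Fin n → Bool) (k : ℕ) (v : Fin n)
    → IsBipartite G → Connected G
    → (∀ x → T (Tm x) → colA G x ≡ true)
    → colA G v ≡ false
    → ((C : Fin n → Bool) → IsSolution G Tm k C → T (C v)
         → HasSolution (contract G v) (contractT G v Tm) (k ∸ 1))
    × (1 ≤ k → HasSolution (contract G v) (contractT G v Tm) (k ∸ 1)
         → HasSolution G Tm k)
lemma4p7 n G Tm k v bip _ Tm⊆A v∈B = contract-solution , expand-solution
  where
  contract-solution : (C : Fin n → Bool) → IsSolution G Tm k C → T (C v)
                    → HasSolution (contract G v) (contractT G v Tm) (k ∸ 1)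
  contract-solution C sol@(C⊆B , _) v∈C =
    pushdown G v C , Solutions.solution-down Tm Tm⊆A C⊆B (pushdown⊆B G v C C⊆B) sol
    where open Compatible G v bip v∈B C (pushdown G v C) v∈C (λ _ _ → refl)

  expand-solution : 1 ≤ k → HasSolution (contract G v) (contractT G v Tm) (k ∸ 1) → HasSolution G Tm k
  expand-solution 1≤k (C′ , sol′@(C′⊆B′ , _)) =
    C , Solutions.solution-up Tm Tm⊆A (pullback⊆B G v C′ v∈B C′⊆B′) C′⊆B′ 1≤k sol′
    where
    C : Fin n → Bool
    C = pullback G v C′
    open Compatible G v bip v∈B C C′ (v∈pullback G v C′) (pullback-agrees G v C′)
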